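{- For every environment $L$ and term $T$ it is decidable whether there exists an arity $A$ such that $L\vdash T::A$.
   Context: Fix a nonempty set $\Sigma$ of sorts and a countably infinite set of variables (with decidable equality). Terms and environments are given by $T,U,V,W ::= \star s \mid x \mid \mathrm{app}(V,T) \mid \lambda x{:}W.\,T \mid \mathrm{def}(x{=}V).\,T \mid \mathrm{cast}(U,T)$ ($s\in\Sigma$, $x$ a variable) and $L,K ::= \emptyset \mid K,x{:}W \mid K,x{=}V$, where $\mathrm{app}(V,T)$ applies $T$ to $V$, $\lambda x{:}W.\,T$ is de Bruijn's abstraction binding $x$ in $T$, $\mathrm{def}(x{=}V).\,T$ is a local definition binding $x$ in $T$, $\mathrm{cast}(U,T)$ annotates $T$ with expected type $U$; environment entries $x{:}W$ (declaration) and $x{=}V$ (definition) bind $x$. Terms are taken modulo renaming of bound variables. Write $K,x[V]$ for either $K,x{:}V$ or $K,x{=}V$. Arities are $A,B::=\circ\mid B\Rightarrow A$. Arity assignment $L\vdash T::A$ is the smallest relation closed under: $L\vdash\star s::\circ$; if $K\vdash V::A$ then $K,x[V]\vdash x::A$; if $K\vdash x::A$ and $y\neq x$ then $K,y[V]\vdash x::A$; if $L\vdash W::B$ and $L,x{:}W\vdash T::A$ then $L\vdash\lambda x{:}W.\,T::B\Rightarrow A$; if $L\vdash V::B$ and $L,x{=}V\vdash T::A$ then $L\vdash\mathrm{def}(x{=}V).\,T::A$; if $L\vdash V::B$ and $L\vdash T::B\Rightarrow A$ then $L\vdash\mathrm{app}(V,T)::A$; if $L\vdash U::A$ and $L\vdash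 T::A$ then $L\vdash\mathrm{cast}(U,T)::A$. -}

module Defs where

open import Data.Nat using (ℕ)
open import Relation.Binary.PropositionalEquality using (_≡_)
open import Relation.Nullary using (¬_)

-- Variables: a countably infinite set with decidable equality; we take ℕ.
Var : Set
Var = ℕ

data Term (S : Set) : Set where
  ⋆_   : S → Term S
  var  : Var → Term S
  app  : Term S → Term S → Term S         -- app(V,T): T applied to V
  lam  : Var → Term S → Term S → Term S
  def  : Var → Term S → Term S → Term S
  cast : Term S → Term S → Term S

data Env (S : Set) : Set where
  ∅    : Env S
  _,_∶_ : Env S → Var → Term S → Env S
  _,_≔_ : Env S → Var → Term S → Env S

data Arity : Set where
  ○    : Arity
  _⇒_  : Arity → Arity → Arity

infixr 5 _⇒_

data _⊢_∷_ {S : Set} : Env S → Term S → Arity → Set where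
  sort  : ∀ {L s} → L ⊢ (⋆ s) ∷ ○
  ldecl : ∀ {K x V A} → K ⊢ V ∷ A → (K , x ∶ V) ⊢ var x ∷ A
  ldef  : ∀ {K x V A} → K ⊢ V ∷ A → (K , x ≔ V) ⊢ var x ∷ A
  ddecl : ∀ {K x y V A} → K ⊢ var x ∷ A → ¬ (y ≡ x) → (K , y ∶ V) ⊢ var x ∷ A
  ddef  : ∀ {K x y V A} → K ⊢ var x ∷ A → ¬ (y ≡ x) → (K , y ≔ V) ⊢ var x ∷ A
  abst  : ∀ {L x W T A B} → L ⊢ W ∷ B → (L , x ∶ W) ⊢ T ∷ A → L ⊢ lam x W T ∷ (B ⇒ A)
  abbr  : ∀ {L x V T A B} → L ⊢ V ∷ B → (L , x ≔ V) ⊢ T ∷ A → L ⊢ def x V T ∷ A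
  appl  : ∀ {L V T A B} → L ⊢ V ∷ B → L ⊢ T ∷ (B ⇒ A) → L ⊢ app V T ∷ A
  cst   : ∀ {L U T A} → L ⊢ U ∷ A → L ⊢ T ∷ A → L ⊢ cast U T ∷ A

module Submission where

-- The decision procedure follows the structure of the term, but the
-- environment grows under binders and the rules for variables look back
-- into the environment, so we do not recurse on the environment directly.
-- Instead the procedure works relative to a *variable table*: a decision,
-- for every variable x, of whether L ⊢ x :: A holds for some A.

open import Defs
open import Data.Empty using (⊥-elim)
open import Data.Nat using (_≟_)
open import Data.Product using (∃; _,_)
open import Relation.Nullary using (Dec; yes; no)
open import Relation.Nullary.Decidable using (map′)
open import Relation.Binary.PropositionalEquality
  using (_≡_; refl; sym; trans; cong; cong₂; subst)

⇒-injectiveˡ : ∀ {B B′ A A′} → B ⇒ A ≡ B′ ⇒ A′ → B ≡ B′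
⇒-injectiveˡ refl = refl

⇒-injectiveʳ : ∀ {B B′ A A′} → B ⇒ A ≡ B′ ⇒ A′ → A ≡ A′
⇒-injectiveʳ refl = refl

_≟ᴬ_ : (A B : Arity) → Dec (A ≡ B)
○ ≟ᴬ ○ = yes refl
○ ≟ᴬ (_ ⇒ _) = no λ ()
(_ ⇒ _) ≟ᴬ ○ = no λ ()
(B ⇒ A) ≟ᴬ (B′ ⇒ A′) with B ≟ᴬ B′ | A ≟ᴬ A′
... | yes refl | yes refl = yes refl
... | no B≢B′  | _        = no λ e → B≢B′ (⇒-injectiveˡ e)
... | yes _    | no A≢A′  = no λ e → A≢A′ (⇒-injectiveʳ e)

accepts? : (B C : Arity) → Dec (∃ λ A → C ≡ B ⇒ A)
accepts? B ○ = no λ { (_ , ()) }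
accepts? B (B′ ⇒ A) =
  map′ (λ { refl → A , refl }) (λ { (_ , e) → sym (⇒-injectiveˡ e) }) (B ≟ᴬ B′)

module _ {S : Set} where

  Assignable : Env S → Term S → Set
  Assignable L T = ∃ λ A → L ⊢ T ∷ A

  -- Uniqueness of arity: the derivation rules are syntax-directed, and the
  -- only two rules for a variable in K,y[V] are separated by y ≟ x.
  unique : ∀ {L : Env S} {T A A′} → L ⊢ T ∷ A → L ⊢ T ∷ A′ → A ≡ A′
  unique sort sort = refl
  unique (ldecl d) (ldecl d′) = unique d d′
  unique (ldecl _) (ddecl _ x≢x) = ⊥-elim (x≢x refl)
  unique (ldef d) (ldef d′) = unique d d′
  unique (ldef _) (ddef _ x≢x) = ⊥-elim (x≢x refl)
  unique (ddecl _ x≢x) (ldecl _) = ⊥-elim (x≢x refl)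
  unique (ddecl d _) (ddecl d′ _) = unique d d′
  unique (ddef _ x≢x) (ldef _) = ⊥-elim (x≢x refl)
  unique (ddef d _) (ddef d′ _) = unique d d′
  unique (abst dW dT) (abst dW′ dT′) = cong₂ _⇒_ (unique dW dW′) (unique dT dT′)
  unique (abbr _ dT) (abbr _ dT′) = unique dT dT′
  unique (appl _ dT) (appl _ dT′) = ⇒-injectiveʳ (unique dT dT′)
  unique (cst _ dT) (cst _ dT′) = unique dT dT′

  VarTable : Env S → Set
  VarTable L = ∀ x → Dec (Assignable L (var x))

  extend-decl : ∀ {K x V} → VarTable K → Dec (Assignable K V) → VarTable (K , x ∶ V)
  extend-decl {x = x} table V? y with x ≟ y
  ... | yes refl = map′ (λ { (A , d) → A , ldecl d })
                        (λ { (A , ldecl d) → A , d ; (_ , ddecl _ x≢x) → ⊥-elim (x≢x refl) })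
                        V?
  ... | no x≢y   = map′ (λ { (A , d) → A , ddecl d x≢y })
                        (λ { (_ , ldecl _) → ⊥-elim (x≢y refl) ; (A , ddecl d _) → A , d })
                        (table y)

  extend-def : ∀ {K x V} → VarTable K → Dec (Assignable K V) → VarTable (K , x ≔ V)
  extend-def {x = x} table V? y with x ≟ y
  ... | yes refl = map′ (λ { (A , d) → A , ldef d })
                        (λ { (A , ldef d) → A , d ; (_ , ddef _ x≢x) → ⊥-elim (x≢x refl) })
                        V?
  ... | no x≢y   = map′ (λ { (A , d) → A , ddef d x≢y })
                        (λ { (_ , ldef _) → ⊥-elim (x≢y refl) ; (A , ddef d _) → A , d })
                        (table y)

  decide : {L : Env S} → VarTable L → (T : Term S) → Dec (Assignable L T)
  decide table (⋆ s) = yes (○ , sort)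
  decide table (var x) = table x
  decide table (lam x W T) with decide table W
  ... | no ¬W = no λ { (_ , abst dW _) → ¬W (_ , dW) }
  ... | yes (B , dW) =
    map′ (λ { (A , dT) → B ⇒ A , abst dW dT })
         (λ { (_ , abst _ dT) → _ , dT })
         (decide (extend-decl table (yes (B , dW))) T)
  decide table (def x V T) with decide table V
  ... | no ¬V = no λ { (_ , abbr dV _) → ¬V (_ , dV) }
  ... | yes (B , dV) =
    map′ (λ { (A , dT) → A , abbr dV dT })
         (λ { (_ , abbr _ dT) → _ , dT })
         (decide (extend-def table (yes (B , dV))) T)
  decide {L} table (app V T) with decide table V | decide table T
  ... | no ¬V | _ = no λ { (_ , appl dV _) → ¬V (_ , dV) }
  ... | yes _ | no ¬T = no λ { (_ , appl _ dT) → ¬T (_ , dT) }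
  ... | yes (B , dV) | yes (C , dT) =
    -- by uniqueness, the application is typable iff C = B ⇒ A for some A
    map′ (λ { (A , C≡B⇒A) → A , appl dV (subst (L ⊢ T ∷_) C≡B⇒A dT) })
         (λ { (A , appl dV′ dT′) →
                A , trans (unique dT dT′) (cong (_⇒ A) (sym (unique dV dV′))) })
         (accepts? B C)
  decide {L} table (cast U T) with decide table U | decide table T
  ... | no ¬U | _ = no λ { (_ , cst dU _) → ¬U (_ , dU) }
  ... | yes _ | no ¬T = no λ { (_ , cst _ dT) → ¬T (_ , dT) }
  ... | yes (B , dU) | yes (C , dT) =
    -- by uniqueness, the cast is typable iff U and T have the same arity
    map′ (λ B≡C → B , cst dU (subst (L ⊢ T ∷_) (sym B≡C) dT))
         (λ { (_ , cst dU′ dT′) → trans (unique dU dU′) (sym (unique dT dT′)) })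
         (B ≟ᴬ C)

  varTable : (L : Env S) → VarTable L
  varTable ∅ x = no λ { (_ , ()) }
  varTable (K , x ∶ V) = extend-decl (varTable K) (decide (varTable K) V)
  varTable (K , x ≔ V) = extend-def (varTable K) (decide (varTable K) V)

theorem4p3 : (S : Set) → S → (L : Env S) → (T : Term S) → Dec (∃ λ A → L ⊢ T ∷ A)
theorem4p3 S _ L T = decide (varTable L) T
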